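{- Let $G$ be a graph with Gallai–Edmonds decomposition $(D,A,C)$, let $\ell$ be an integer, and for an instance $(H,\ell)$ let $\mu(H,\ell) = \frac{1}{2}(\mathsf{MM}(H) + \mathsf{IS}(H)) - \ell$. Let $u, v \in A$ be adjacent. Then for each $G_i \in \{G - u,\ G - v,\ G - N(\{u,v\})\}$ we have $\mu(G_i,\ell) \le \mu(G,\ell) - \frac{1}{2}$.
   Context: All graphs are finite, simple and undirected. $\mathsf{MM}(G)$ denotes the maximum size of a matching, $\mathsf{IS}(G)$ the maximum size of an independent set. For $X \subseteq V(G)$, $N(X) = \bigcup_{x\in X} N(x) \setminus X$. The Gallai–Edmonds decomposition of $G$ is the partition of $V(G)$ into $D = \{v : \text{some maximum matching of } G \text{ misses } v\}$, $A = N(D)$, and $C = V(G) \setminus (A \cup D)$. -}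

module Defs where

open import Level using (0ℓ)
open import Data.Nat as ℕ using (ℕ)
open import Data.Integer as ℤ using (ℤ; +_)
open import Data.Rational as ℚ using (ℚ; ½)
open import Data.Fin using (Fin)
open import Data.List using (List; length)
open import Data.List.Relation.Unary.All using (All)
open import Data.List.Relation.Unary.AllPairs using (AllPairs)
open import Data.Product using (Σ; ∃; ∃-syntax; _×_; proj₁; proj₂)
open import Data.Sum using (_⊎_)
open import Data.Unit using (⊤)
open import Relation.Nullary using (¬_)
open import Relation.Binary.PropositionalEquality using (_≡_; _≢_)

record Graph (n : ℕ) : Set₁ where
  field
    Adj   : Fin n → Fin n → Set
    sym   : ∀ {x y} → Adj x y → Adj y x
    irrefl : ∀ {x} → ¬ Adj x x
open Graph public

-- Vertex subsets are predicates on Fin n; G[S] is the induced subgraph.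
VSet : ℕ → Set₁
VSet n = Fin n → Set

allV : ∀ {n} → VSet n
allV _ = ⊤

module _ {n : ℕ} (G : Graph n) where

  EdgeIn : VSet n → Fin n × Fin n → Set
  EdgeIn S e = S (proj₁ e) × S (proj₂ e) × Adj G (proj₁ e) (proj₂ e)

  Disjoint : Fin n × Fin n → Fin n × Fin n → Set
  Disjoint e f = proj₁ e ≢ proj₁ f × proj₁ e ≢ proj₂ f
               × proj₂ e ≢ proj₁ f × proj₂ e ≢ proj₂ f

  IsMatching : VSet n → List (Fin n × Fin n) → Set
  IsMatching S M = All (EdgeIn S) M × AllPairs Disjoint M

  IsIndep : VSet n → List (Fin n) → Set
  IsIndep S I = All S I × AllPairs (λ x y → x ≢ y × ¬ Adj G x y) I

  IsMaxMatching : VSet n → List (Fin n × Fin n) → Set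
  IsMaxMatching S M = IsMatching S M
    × (∀ M′ → IsMatching S M′ → length M′ ℕ.≤ length M)

  IsMM : VSet n → ℕ → Set
  IsMM S k = (∃[ M ] (IsMatching S M × length M ≡ k))
    × (∀ M → IsMatching S M → length M ℕ.≤ k)

  IsIS : VSet n → ℕ → Set
  IsIS S k = (∃[ I ] (IsIndep S I × length I ≡ k))
    × (∀ I → IsIndep S I → length I ℕ.≤ k)

  Covers : List (Fin n × Fin n) → Fin n → Set
  Covers M v = Data.List.Relation.Unary.Any.Any (λ e → v ≡ proj₁ e ⊎ v ≡ proj₂ e) M
    where import Data.List.Relation.Unary.Any

  -- Gallai–Edmonds: D = vertices missed by some maximum matching of G
  InD : Fin n → Set
  InD v = ∃[ M ] (IsMaxMatching allV M × ¬ Covers M v)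

  InA : Fin n → Set
  InA v = ¬ InD v × ∃[ d ] (InD d × Adj G v d)

  InC : Fin n → Set
  InC v = ¬ InA v × ¬ InD v

  InN₂ : Fin n → Fin n → Fin n → Set
  InN₂ u v x = (Adj G x u ⊎ Adj G x v) × x ≢ u × x ≢ v

minusV : ∀ {n} → Fin n → VSet n
minusV u x = x ≢ u

μ : ℕ → ℕ → ℤ → ℚ
μ mm is ℓ = ½ ℚ.* ((+ (mm ℕ.+ is)) ℚ./ 1) ℚ.- (ℓ ℚ./ 1)

module _ {n : ℕ} (G : Graph n) where
  DropsByHalf : VSet n → ℤ → ℕ → ℕ → Set
  DropsByHalf S ℓ mm is = ∀ mm′ is′ → IsMM G S mm′ → IsIS G S is′ →
    μ mm′ is′ ℓ ℚ.≤ μ mm is ℓ ℚ.- ½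

-- μ drops by ½ as soon as MM + IS drops by at least 1, and IS cannot grow on an induced
-- subgraph, so it suffices that MM drops.  Every maximum matching covers u and v, which lie
-- outside D, so MM(G − u), MM(G − v) < MM(G).  In G − N({u,v}) the only edge at u or v is uv,
-- so a matching there has at most one edge more than some matching L of G missing u and v.
-- Such an L has at most MM(G) − 2 edges: otherwise L + uv is maximum, and the alternating
-- path that starts at a D-neighbour d of u, taken against a maximum matching missing d,
-- yields either a larger matching or a maximum matching missing u or v.
module Submission where

open import Defs
open import Data.Nat as ℕ using (ℕ; suc; _≤_; _<_)
import Data.Nat.Properties as ℕ
open import Data.Integer as ℤ using (ℤ; +_)
import Data.Integer.Properties as ℤ
open import Data.Rational as ℚ using (ℚ; mkℚ; _/_; ½; 1ℚ; toℚᵘ)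
import Data.Rational.Properties as ℚ
import Data.Rational.Unnormalised as ℚᵘ
import Data.Rational.Unnormalised.Properties as ℚᵘ
open import Data.Rational.Solver using (module +-*-Solver)
import Data.Nat.Coprimality as Coprime
open import Data.Fin using (Fin; _≟_)
open import Data.List using (List; []; _∷_; length)
open import Data.List.Relation.Unary.All as All using (All; []; _∷_)
open import Data.List.Relation.Unary.AllPairs using ([]; _∷_)
open import Data.List.Relation.Unary.Any using (here; there; any?)
open import Data.Product using (∃-syntax; _×_; _,_; proj₁; proj₂)
open import Data.Sum using (_⊎_; inj₁; inj₂)
open import Data.Unit using (tt)
open import Data.Empty using (⊥; ⊥-elim)
open import Function using (_∘_; id)
open import Relation.Nullary using (¬_; Dec; yes; no)
open import Relation.Nullary.Decidable using (_⊎-dec_)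
open import Relation.Unary using (Decidable)
open import Relation.Binary.PropositionalEquality
  using (_≡_; _≢_; refl; trans; cong; subst) renaming (sym to ≡-sym)

/1≡mkℚ : ∀ m → + m / 1 ≡ mkℚ (+ m) 0 (Coprime.sym (Coprime.1-coprimeTo m))
/1≡mkℚ m = ℚ.normalize-coprime (Coprime.sym (Coprime.1-coprimeTo m))

/1-mono-≤ : ∀ {m n} → m ≤ n → + m / 1 ℚ.≤ + n / 1
/1-mono-≤ {m} {n} m≤n rewrite /1≡mkℚ m | /1≡mkℚ n =
  ℚ.*≤* (ℤ.*-monoʳ-≤-nonNeg (+ 1) (ℤ.+≤+ m≤n))

/1-suc : ∀ m → + suc m / 1 ≡ 1ℚ ℚ.+ + m / 1
/1-suc m = ℚ.toℚᵘ-injective (begin-equality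
  toℚᵘ (+ suc m / 1)                ≃⟨ ℚ.toℚᵘ-fromℚᵘ (+ suc m ℚᵘ./ 1) ⟩
  + suc m ℚᵘ./ 1                    ≃⟨ ℚᵘ.*≡* (cong (λ i → (+ 1 ℤ.+ i) ℤ.* + 1)
                                                     (≡-sym (ℤ.*-identityʳ (+ m)))) ⟩
  ℚᵘ.1ℚᵘ ℚᵘ.+ + m ℚᵘ./ 1            ≃⟨ ℚᵘ.+-congʳ ℚᵘ.1ℚᵘ (ℚ.toℚᵘ-fromℚᵘ (+ m ℚᵘ./ 1)) ⟨
  toℚᵘ 1ℚ ℚᵘ.+ toℚᵘ (+ m / 1)       ≃⟨ ℚ.toℚᵘ-homo-+ 1ℚ (+ m / 1) ⟨
  toℚᵘ (1ℚ ℚ.+ + m / 1)             ∎)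
  where open ℚᵘ.≤-Reasoning

μ-decrease : ∀ {mm is mm′ is′} ℓ → suc (mm′ ℕ.+ is′) ≤ mm ℕ.+ is →
             μ mm′ is′ ℓ ℚ.≤ μ mm is ℓ ℚ.- ½
μ-decrease {mm} {is} {mm′} {is′} ℓ lt = begin
  ½ ℚ.* A ℚ.- L                             ≡⟨ shift-half ½ A L ⟩
  (½ ℚ.* (1ℚ ℚ.+ A) ℚ.- L) ℚ.- ½            ≡⟨ cong (λ x → (½ ℚ.* x ℚ.- L) ℚ.- ½) (/1-suc a) ⟨
  (½ ℚ.* (+ suc a / 1) ℚ.- L) ℚ.- ½         ≤⟨ ℚ.+-monoˡ-≤ (ℚ.- ½) (ℚ.+-monoˡ-≤ (ℚ.- L)
                                                 (ℚ.*-monoˡ-≤-nonNeg ½ (/1-mono-≤ lt))) ⟩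
  (½ ℚ.* (+ (mm ℕ.+ is) / 1) ℚ.- L) ℚ.- ½   ∎
  where
    open ℚ.≤-Reasoning
    open +-*-Solver
    a : ℕ
    a = mm′ ℕ.+ is′
    A L : ℚ
    A = + a / 1
    L = ℓ / 1
    shift-half : ∀ h x l → h ℚ.* x ℚ.- l ≡ (h ℚ.* (1ℚ ℚ.+ x) ℚ.- l) ℚ.- h
    shift-half = solve 3 (λ h x l → h :* x :- l := (h :* (con 1ℚ :+ x) :- l) :- h) refl

module _ {n : ℕ} (G : Graph n) where

  private
    Edge : Set
    Edge = Fin n × Fin n

  covers? : ∀ M z → Dec (Covers G M z)
  covers? M z = any? (λ e → (z ≟ proj₁ e) ⊎-dec (z ≟ proj₂ e)) M

  covers⇒≢ : ∀ {M z w} → Covers G M z → ¬ Covers G M w → z ≢ w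
  covers⇒≢ Mz M∌w refl = M∌w Mz

  ¬covers-∷ : ∀ {a b M z} → z ≢ a → z ≢ b → ¬ Covers G M z → ¬ Covers G ((a , b) ∷ M) z
  ¬covers-∷ z≢a z≢b M∌z (here (inj₁ z≡a)) = z≢a z≡a
  ¬covers-∷ z≢a z≢b M∌z (here (inj₂ z≡b)) = z≢b z≡b
  ¬covers-∷ z≢a z≢b M∌z (there Mz)        = M∌z Mz

  disjoint⇒¬covers : ∀ {a b M} → All (Disjoint G (a , b)) M →
                     ¬ Covers G M a × ¬ Covers G M b
  disjoint⇒¬covers [] = (λ ()) , (λ ())
  disjoint⇒¬covers ((a≢c , a≢d , b≢c , b≢d) ∷ ds) =
    ¬covers-∷ a≢c a≢d (proj₁ (disjoint⇒¬covers ds)) ,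
    ¬covers-∷ b≢c b≢d (proj₂ (disjoint⇒¬covers ds))

  ¬covers⇒disjoint : ∀ {a b} M → ¬ Covers G M a → ¬ Covers G M b → All (Disjoint G (a , b)) M
  ¬covers⇒disjoint []      M∌a M∌b = []
  ¬covers⇒disjoint (_ ∷ M) M∌a M∌b =
    (M∌a ∘ here ∘ inj₁ , M∌a ∘ here ∘ inj₂ , M∌b ∘ here ∘ inj₁ , M∌b ∘ here ∘ inj₂)
    ∷ ¬covers⇒disjoint M (M∌a ∘ there) (M∌b ∘ there)

  covered⇒∈ : ∀ {S M z} → All (EdgeIn G S) M → Covers G M z → S z
  covered⇒∈ ((Sa , _) ∷ _)      (here (inj₁ refl)) = Sa
  covered⇒∈ ((_ , Sb , _) ∷ _)  (here (inj₂ refl)) = Sb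
  covered⇒∈ (_ ∷ es)            (there Mz)         = covered⇒∈ es Mz

  IsMatching-restrict : ∀ {S T : VSet n} {M} → IsMatching G S M →
                        (∀ {z} → Covers G M z → T z) → IsMatching G T M
  IsMatching-restrict {M = []}    ([] , ps)            T⊇M = [] , ps
  IsMatching-restrict {M = _ ∷ M} ((_ , _ , ab) ∷ es , d ∷ ps) T⊇M =
    let es′ , ps′ = IsMatching-restrict (es , ps) (T⊇M ∘ there) in
    (T⊇M (here (inj₁ refl)) , T⊇M (here (inj₂ refl)) , ab) ∷ es′ , d ∷ ps′

  IsMatching-mono : ∀ {S T : VSet n} {M} → (∀ {z} → S z → T z) →
                    IsMatching G S M → IsMatching G T M
  IsMatching-mono S⊆T m = IsMatching-restrict m (S⊆T ∘ covered⇒∈ (proj₁ m))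

  IsMatching-∷ : ∀ {T : VSet n} {M a b} → IsMatching G T M → T a → T b → Adj G a b →
                 ¬ Covers G M a → ¬ Covers G M b → IsMatching G T ((a , b) ∷ M)
  IsMatching-∷ {M = M} (es , ps) Ta Tb ab M∌a M∌b =
    (Ta , Tb , ab) ∷ es , ¬covers⇒disjoint M M∌a M∌b ∷ ps

  toAllV : ∀ {S : VSet n} {M} → IsMatching G S M → IsMatching G allV M
  toAllV = IsMatching-mono (λ _ → tt)

  record Mate (S : VSet n) (M : List Edge) (q : Fin n) : Set where
    constructor mate
    field
      r          : Fin n
      rest       : List Edge
      q~r        : Adj G q r
      rest-match : IsMatching G S rest
      length-≡   : length M ≡ suc (length rest)
      rest∌q     : ¬ Covers G rest q
      rest∌r     : ¬ Covers G rest r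
      rest⊆      : ∀ {z} → Covers G rest z → Covers G M z
      covers-r   : Covers G M r

  mateOf : ∀ {S M q} → IsMatching G S M → Covers G M q → Mate S M q
  mateOf {M = (a , b) ∷ M} ((_ , _ , ab) ∷ es , ds ∷ ps) (here (inj₁ refl)) =
    mate b M ab (es , ps) refl (proj₁ (disjoint⇒¬covers ds)) (proj₂ (disjoint⇒¬covers ds))
         there (here (inj₂ refl))
  mateOf {M = (a , b) ∷ M} ((_ , _ , ab) ∷ es , ds ∷ ps) (here (inj₂ refl)) =
    mate a M (Graph.sym G ab) (es , ps) refl (proj₂ (disjoint⇒¬covers ds))
         (proj₁ (disjoint⇒¬covers ds)) there (here (inj₁ refl))
  mateOf {M = (a , b) ∷ M} ((Sa , Sb , ab) ∷ es , ds ∷ ps) (there Mq)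
    with mateOf (es , ps) Mq
  ... | mate r M₀ qr mM₀ len M₀∌q M₀∌r M₀⊆M Mr =
    mate r ((a , b) ∷ M₀) qr (IsMatching-∷ mM₀ Sa Sb ab (M∌a ∘ M₀⊆M) (M∌b ∘ M₀⊆M))
         (cong suc len)
         (¬covers-∷ (covers⇒≢ Mq M∌a) (covers⇒≢ Mq M∌b) M₀∌q)
         (¬covers-∷ (covers⇒≢ Mr M∌a) (covers⇒≢ Mr M∌b) M₀∌r)
         (λ { (here e) → here e ; (there c) → there (M₀⊆M c) }) (there Mr)
    where
      M∌a : ¬ Covers G M a
      M∌a = proj₁ (disjoint⇒¬covers ds)
      M∌b : ¬ Covers G M b
      M∌b = proj₂ (disjoint⇒¬covers ds)

  _∪｛_｝ : VSet n → Fin n → VSet n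
  (S ∪｛ p ｝) z = S z ⊎ z ≡ p

  _∖｛_,_｝ : VSet n → Fin n → Fin n → VSet n
  (S ∖｛ q , r ｝) z = S z × z ≢ q × z ≢ r

  IsMatching-∷-outside : ∀ {S T : VSet n} {M p q} → ¬ S p → S q → Adj G p q →
    (∀ {z} → T z → S z) → IsMatching G T M → ¬ Covers G M q →
    IsMatching G (S ∪｛ p ｝) ((p , q) ∷ M)
  IsMatching-∷-outside ¬Sp Sq pq T⊆S m M∌q =
    IsMatching-∷ (IsMatching-mono (inj₁ ∘ T⊆S) m) (inj₂ refl) (inj₁ Sq) pq
      (¬Sp ∘ T⊆S ∘ covered⇒∈ (proj₁ m)) M∌q

  module Alternating (X : VSet n) (X? : Decidable X) where

    Avoids : List Edge → Set
    Avoids M = ∀ {z} → X z → ¬ Covers G M z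

    data Outcome (S : VSet n) (p : Fin n) (N L : List Edge) : Set where
      augment : ∀ {N′} → IsMatching G (S ∪｛ p ｝) N′ → length N′ ≡ suc (length N) →
                Outcome S p N L
      extend  : ∀ {L′} → IsMatching G S L′ → Avoids L′ → length L′ ≡ suc (length L) →
                Outcome S p N L
      expose  : ∀ {N′ z} → IsMatching G (S ∪｛ p ｝) N′ → X z → ¬ Covers G N′ z →
                length N′ ≡ length N → Outcome S p N L

    ∉X⇒≢ : ∀ {a z} → ¬ X a → X z → z ≢ a
    ∉X⇒≢ ¬Xa Xz refl = ¬Xa Xz

    Outcome-shift : ∀ {S N N₀ L L₀ p q r} → ¬ S p → S q → S r → Adj G p q → Adj G q r →
      ¬ X p → ¬ X q → ¬ X r → length N ≡ suc (length N₀) → length L ≡ suc (length L₀) →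
      Outcome (S ∖｛ q , r ｝) r N₀ L₀ → Outcome S p N L
    Outcome-shift {S} {N} {N₀} {L} {L₀} {p} {q} {r} ¬Sp Sq Sr pq qr ¬Xp ¬Xq ¬Xr |N|≡ |L|≡ = shift
      where
        up : ∀ {z} → ((S ∖｛ q , r ｝) ∪｛ r ｝) z → S z
        up (inj₁ (Sz , _)) = Sz
        up (inj₂ refl)     = Sr
        q∉ : ∀ {M} → IsMatching G ((S ∖｛ q , r ｝) ∪｛ r ｝) M → ¬ Covers G M q
        q∉ m c with covered⇒∈ (proj₁ m) c
        ... | inj₁ (_ , q≢q , _) = q≢q refl
        ... | inj₂ refl          = Graph.irrefl G qr
        shift : Outcome (S ∖｛ q , r ｝) r N₀ L₀ → Outcome S p N L
        shift (augment m len) =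
          augment (IsMatching-∷-outside ¬Sp Sq pq up m (q∉ m)) (cong suc (trans len (≡-sym |N|≡)))
        shift (extend m av len) =
          extend (IsMatching-∷ (IsMatching-mono proj₁ m) Sq Sr qr
                   (λ c → proj₁ (proj₂ (covered⇒∈ (proj₁ m) c)) refl)
                   (λ c → proj₂ (proj₂ (covered⇒∈ (proj₁ m) c)) refl))
                 (λ Xz → ¬covers-∷ (∉X⇒≢ ¬Xq Xz) (∉X⇒≢ ¬Xr Xz) (av Xz))
                 (cong suc (trans len (≡-sym |L|≡)))
        shift (expose m Xz M∌z len) =
          expose (IsMatching-∷-outside ¬Sp Sq pq up m (q∉ m)) Xz
                 (¬covers-∷ (∉X⇒≢ ¬Xp Xz) (∉X⇒≢ ¬Xq Xz) M∌z) (trans (cong suc len) (≡-sym |N|≡))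

    -- Walk along p, q, the N-mate r of q, the L-mate s of r, …, replacing the N-edge qr by pq
    -- and continuing from the edge rs in G − {q, r}; the fuel k bounds the length of L.
    alternate : ∀ k {S N L p q} → length L < k →
                IsMatching G S N → IsMatching G S L → Avoids L → ¬ Covers G L q →
                ¬ S p → S q → Adj G p q → ¬ X p → ¬ X q → Outcome S p N L
    alternate (suc k) {S} {N} {L} {p} {q} |L|<k mN mL L∌X L∌q ¬Sp Sq pq ¬Xp ¬Xq =
      step (covers? N q)
      where
        viaMate : Mate S N q → Outcome S p N L
        viaMate (mate r N₀ qr mN₀ |N|≡ N₀∌q N₀∌r _ Nr) = branch (covers? L r) (X? r)
          where
            Sr : S r
            Sr = covered⇒∈ (proj₁ mN) Nr

            recurse : Covers G L r → Mate S L r → Outcome S p N L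
            recurse Lr (mate s L₀ rs mL₀ |L|≡ L₀∌r L₀∌s L₀⊆L Ls) =
              Outcome-shift ¬Sp Sq Sr pq qr ¬Xp ¬Xq (λ Xr → L∌X Xr Lr) |N|≡ |L|≡
                (alternate k (ℕ.≤-pred (subst (_< suc k) |L|≡ |L|<k))
                   (IsMatching-restrict mN₀ λ c →
                      covered⇒∈ (proj₁ mN₀) c , covers⇒≢ c N₀∌q , covers⇒≢ c N₀∌r)
                   (IsMatching-restrict mL₀ λ c →
                      covered⇒∈ (proj₁ mL₀) c , covers⇒≢ (L₀⊆L c) L∌q , covers⇒≢ c L₀∌r)
                   (λ Xz → L∌X Xz ∘ L₀⊆L) L₀∌s (λ (_ , _ , r≢r) → r≢r refl)
                   (covered⇒∈ (proj₁ mL) Ls , covers⇒≢ Ls L∌q , λ { refl → Graph.irrefl G rs })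
                   rs (λ Xr → L∌X Xr Lr) (λ Xs → L∌X Xs Ls))

            branch : Dec (Covers G L r) → Dec (X r) → Outcome S p N L
            branch (no L∌r) (yes Xr) =
              expose (IsMatching-∷-outside ¬Sp Sq pq id mN₀ N₀∌q) Xr
                     (¬covers-∷ (λ { refl → ¬Sp Sr }) (λ { refl → Graph.irrefl G qr }) N₀∌r)
                     (≡-sym |N|≡)
            branch (no L∌r) (no ¬Xr) =
              extend (IsMatching-∷ mL Sq Sr qr L∌q L∌r)
                     (λ Xz → ¬covers-∷ (∉X⇒≢ ¬Xq Xz) (∉X⇒≢ ¬Xr Xz) (L∌X Xz)) refl
            branch (yes Lr) _ = recurse Lr (mateOf mL Lr)

        step : Dec (Covers G N q) → Outcome S p N L
        step (no N∌q) = augment (IsMatching-∷-outside ¬Sp Sq pq id mN N∌q) refl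
        step (yes Nq) = viaMate (mateOf mN Nq)

  maximum-misses⇒InD : ∀ {mm T M z} → IsMM G allV mm → IsMatching G T M → length M ≡ mm →
                       ¬ Covers G M z → InD G z
  maximum-misses⇒InD (_ , bound) m refl M∌z = _ , (toAllV m , bound) , M∌z

  maximum-length : ∀ {mm N} → IsMM G allV mm → IsMaxMatching G allV N → length N ≡ mm
  maximum-length ((W , mW , refl) , bound) (mN , maxN) = ℕ.≤-antisym (bound _ mN) (maxN W mW)

  avoiding-pair-not-near-maximum : ∀ {u v d mm L} → ¬ InD G u → ¬ InD G v → u ≢ v →
    InD G d → Adj G u d → IsMM G allV mm → IsMatching G allV L →
    ¬ Covers G L u → ¬ Covers G L v → suc (length L) ≢ mm
  avoiding-pair-not-near-maximum {u} {v} {d} {mm} {L}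
    u∉D v∉D u≢v d∈D@(N , maxN , N∌d) u~d isMM mL L∌u L∌v |L|+1≡mm = split (covers? L d)
    where
      open Alternating (λ z → z ≡ u ⊎ z ≡ v) (λ z → (z ≟ u) ⊎-dec (z ≟ v))

      pair∉D : ∀ {z} → z ≡ u ⊎ z ≡ v → ¬ InD G z
      pair∉D (inj₁ refl) = u∉D
      pair∉D (inj₂ refl) = v∉D

      L∌pair : Avoids L
      L∌pair (inj₁ refl) = L∌u
      L∌pair (inj₂ refl) = L∌v

      add-ud : ∀ {L′} → IsMatching G allV L′ → Avoids L′ → ¬ Covers G L′ d →
               suc (length L′) ≢ mm
      add-ud m L′∌pair L′∌d len =
        v∉D (maximum-misses⇒InD isMM (IsMatching-∷ m tt tt u~d (L′∌pair (inj₁ refl)) L′∌d) len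
              (¬covers-∷ (u≢v ∘ ≡-sym) (λ { refl → v∉D d∈D }) (L′∌pair (inj₂ refl))))

      viaMate : Mate allV L d → ⊥
      viaMate (mate q L₀ d~q mL₀ |L|≡ L₀∌d L₀∌q L₀⊆L Lq) = conclude outcome
        where
          S : VSet n
          S z = z ≢ d
          outcome : Outcome S d N L₀
          outcome = alternate (suc (length L₀)) (ℕ.n<1+n _)
            (IsMatching-restrict (proj₁ maxN) (λ c → covers⇒≢ c N∌d))
            (IsMatching-restrict mL₀ (λ c → covers⇒≢ c L₀∌d))
            (λ Xz → L∌pair Xz ∘ L₀⊆L) L₀∌q (λ d≢d → d≢d refl) (λ { refl → Graph.irrefl G d~q })
            d~q (λ Xd → pair∉D Xd d∈D) (λ Xq → L∌pair Xq Lq)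
          |N|≡mm : length N ≡ mm
          |N|≡mm = maximum-length isMM maxN
          conclude : Outcome S d N L₀ → ⊥
          conclude (augment m len) =
            ℕ.1+n≰n (subst (_≤ mm) (trans len (cong suc |N|≡mm)) (proj₂ isMM _ (toAllV m)))
          conclude (extend m L′∌pair len) =
            add-ud (toAllV m) L′∌pair (λ c → covered⇒∈ (proj₁ m) c refl)
                   (trans (cong suc (trans len (≡-sym |L|≡))) |L|+1≡mm)
          conclude (expose m Xz M∌z len) =
            pair∉D Xz (maximum-misses⇒InD isMM m (trans len |N|≡mm) M∌z)

      split : Dec (Covers G L d) → ⊥
      split (no L∌d)  = add-ud mL L∌pair L∌d |L|+1≡mm
      split (yes Ld) = viaMate (mateOf mL Ld)

  OutsideN₂ : Fin n → Fin n → VSet n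
  OutsideN₂ u v x = ¬ InN₂ G u v x

  outsideN₂-neighbour : ∀ {u v a b} → OutsideN₂ u v b → a ≡ u ⊎ a ≡ v → Adj G a b →
                        b ≡ u ⊎ b ≡ v
  outsideN₂-neighbour {u} {v} {a} {b} b∉N a∈uv a~b with b ≟ u | b ≟ v
  ... | yes b≡u | _       = inj₁ b≡u
  ... | no _    | yes b≡v = inj₂ b≡v
  ... | no b≢u  | no b≢v  = ⊥-elim (b∉N (b~uv a∈uv , b≢u , b≢v))
    where
      b~uv : a ≡ u ⊎ a ≡ v → Adj G b u ⊎ Adj G b v
      b~uv (inj₁ refl) = inj₁ (Graph.sym G a~b)
      b~uv (inj₂ refl) = inj₂ (Graph.sym G a~b)

  remove-pair : ∀ {u v M} → IsMatching G (OutsideN₂ u v) M →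
    ∃[ L ] IsMatching G allV L × ¬ Covers G L u × ¬ Covers G L v × length M ≤ suc (length L)
  remove-pair {u} {v} {M} m = split (covers? M u) (covers? M v)
    where
      mate∈pair : ∀ {a} → a ≡ u ⊎ a ≡ v → (mt : Mate (OutsideN₂ u v) M a) →
                  Mate.r mt ≡ u ⊎ Mate.r mt ≡ v
      mate∈pair a∈uv mt =
        outsideN₂-neighbour (covered⇒∈ (proj₁ m) (Mate.covers-r mt)) a∈uv (Mate.q~r mt)

      split : Dec (Covers G M u) → Dec (Covers G M v) →
        ∃[ L ] IsMatching G allV L × ¬ Covers G L u × ¬ Covers G L v × length M ≤ suc (length L)
      split (yes Mu) _ with mateOf m Mu
      ... | mt@(mate r M₀ u~r mM₀ len M₀∌u M₀∌r _ _) with mate∈pair (inj₁ refl) mt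
      ...   | inj₁ refl = ⊥-elim (Graph.irrefl G u~r)
      ...   | inj₂ refl = M₀ , toAllV mM₀ , M₀∌u , M₀∌r , ℕ.≤-reflexive len
      split (no M∌u) (yes Mv) with mateOf m Mv
      ... | mt@(mate r _ v~r _ _ _ _ _ Mr) with mate∈pair (inj₂ refl) mt
      ...   | inj₁ refl = ⊥-elim (M∌u Mr)
      ...   | inj₂ refl = ⊥-elim (Graph.irrefl G v~r)
      split (no M∌u) (no M∌v) = M , toAllV m , M∌u , M∌v , ℕ.n≤1+n _

  MM-minusV< : ∀ {u mm mm′} → ¬ InD G u → IsMM G allV mm → IsMM G (minusV u) mm′ → mm′ < mm
  MM-minusV< u∉D isMM ((M , m , refl) , _) =
    ℕ.≤∧≢⇒< (proj₂ isMM M (toAllV m))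
      (λ |M|≡mm → u∉D (maximum-misses⇒InD isMM m |M|≡mm (λ c → covered⇒∈ (proj₁ m) c refl)))

  MM-outsideN₂< : ∀ {u v mm mm′} → InA G u → InA G v → Adj G u v → IsMM G allV mm →
                  IsMM G (OutsideN₂ u v) mm′ → mm′ < mm
  MM-outsideN₂< (u∉D , d , d∈D , u~d) (v∉D , _) u~v isMM ((M , m , refl) , _)
    with remove-pair m
  ... | L , mL , L∌u , L∌v , |M|≤ =
    ℕ.≤-<-trans |M|≤ (ℕ.≤∧≢⇒< (proj₂ isMM _ (IsMatching-∷ mL tt tt u~v L∌u L∌v))
      (avoiding-pair-not-near-maximum u∉D v∉D (λ { refl → Graph.irrefl G u~v }) d∈D u~d
         isMM mL L∌u L∌v))

  IS-induced-≤ : ∀ {S is is′} → IsIS G allV is → IsIS G S is′ → is′ ≤ is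
  IS-induced-≤ (_ , bound) ((I , (_ , distinct) , refl) , _) =
    bound I (All.universal (λ _ → tt) I , distinct)

  dropsByHalf : ∀ {S mm is} ℓ → (∀ {mm′} → IsMM G S mm′ → mm′ < mm) → IsIS G allV is →
                DropsByHalf G S ℓ mm is
  dropsByHalf {mm = mm} {is} ℓ MM< isIS mm′ is′ isMM′ isIS′ =
    μ-decrease {mm} {is} {mm′} {is′} ℓ (ℕ.+-mono-<-≤ (MM< isMM′) (IS-induced-≤ isIS isIS′))

lemma8 : (n : ℕ) (G : Graph n) (ℓ : ℤ) (u v : Fin n) →
    InA G u → InA G v → Adj G u v →
    (mm is : ℕ) → IsMM G allV mm → IsIS G allV is →
    DropsByHalf G (minusV u) ℓ mm is
    × DropsByHalf G (minusV v) ℓ mm is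
    × DropsByHalf G (λ x → ¬ InN₂ G u v x) ℓ mm is
lemma8 n G ℓ u v u∈A v∈A u~v mm is isMM isIS =
  dropsByHalf G ℓ (MM-minusV< G (proj₁ u∈A) isMM) isIS ,
  dropsByHalf G ℓ (MM-minusV< G (proj₁ v∈A) isMM) isIS ,
  dropsByHalf G ℓ (MM-outsideN₂< G u∈A v∈A u~v isMM) isIS
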